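{- Let $X$ be a finite non-empty set and $R$ a monotone transit function on $X$ satisfying (uc): for all $x,y,u,v\in X$, if $R(x,y)\cap R(u,v)\neq\emptyset$ then there are $p,q\in R(x,y)\cup R(u,v)$ with $R(x,y)\cup R(u,v)=R(p,q)$. Then the family of transit sets $\mathcal{C}_R=\{R(x,y)\mid x,y\in X\}$ is pre-pyramidal: there is a total order $<$ on $X$ such that every $R(x,y)$ is an interval for $<$ (i.e., for all $a,b\in R(x,y)$ and $c\in X$, $a<c<b$ implies $c\in R(x,y)$).
   Context: A transit function on a finite non-empty set $X$ is a map $R:X\times X\to 2^X$ such that for all $u,v\in X$: $u\in R(u,v)$, $R(u,v)=R(v,u)$, and $R(u,u)=\{u\}$. $R$ is monotone if for all $u,v,p,q\in X$, $p,q\in R(u,v)$ implies $R(p,q)\subseteq R(u,v)$. -}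

module Defs where

open import Data.Nat using (ℕ)
open import Data.Fin using (Fin)
open import Data.Fin.Subset using (Subset; _∈_; _∉_; _⊆_; _∪_; _∩_; Empty)
open import Data.Product using (Σ; ∃; _×_; _,_)
open import Relation.Nullary using (¬_)
open import Relation.Binary.PropositionalEquality using (_≡_)
open import Relation.Binary.Structures using (IsStrictTotalOrder)
open import Level using (Level; suc; _⊔_; 0ℓ)

record IsTransit {n : ℕ} (R : Fin n → Fin n → Subset n) : Set where
  field
    t1 : ∀ u v → u ∈ R u v
    t2 : ∀ u v → R u v ≡ R v u
    t3 : ∀ u w → w ∈ R u u → w ≡ u

Monotone : {n : ℕ} → (Fin n → Fin n → Subset n) → Set
Monotone R = ∀ u v p q → p ∈ R u v → q ∈ R u v → R p q ⊆ R u v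

UC : {n : ℕ} → (Fin n → Fin n → Subset n) → Set
UC R = ∀ x y u v → ¬ Empty (R x y ∩ R u v) →
  Σ _ λ p → Σ _ λ q → p ∈ (R x y ∪ R u v) × q ∈ (R x y ∪ R u v)
    × (R x y ∪ R u v) ≡ R p q

IsInterval : {n : ℕ} → (Fin n → Fin n → Set) → Subset n → Set
IsInterval _<_ S = ∀ a b c → a ∈ S → b ∈ S → a < c → c < b → c ∈ S

PrePyramidal : {n : ℕ} → (Fin n → Fin n → Subset n) → Set₁
PrePyramidal {n} R = Σ (Fin n → Fin n → Set) λ _<_ →
  IsStrictTotalOrder _≡_ _<_ × (∀ x y → IsInterval _<_ (R x y))

-- Call e an end of Y when the sets R e c (c ∈ Y) are nested. Two facts are proved together
-- by induction on ∣ Y ∣: every end e starts a ranking of Y (an injective rank in which every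
-- R x y is an interval), and Y = R l r for two ends l and r. The tool throughout is the
-- triangle law R x z ⊆ R x y ∪ R y z, which (uc) and monotonicity give directly.
-- Ranking from e: let m ≠ e minimise R e m. One of the two spanning ends of R e m - e is an
-- end f of Y - e (for R with e deleted); rank Y - e from f by induction and put e first.
-- Ends: a largest transit set A ≠ Y has spanning ends by induction, and the one farther from
-- a point z ∉ A is an end of Y, because (uc) forces R a b ∪ A = Y for every b ∉ A. The last
-- point of a ranking from that end is the second end.

module Submission where

open import Defs
open import Level using (0ℓ)
open import Function.Base using (id; _on_)
open import Function.Definitions using (Injective)
open import Data.Empty using (⊥-elim)
open import Data.Product using (Σ; ∃; _×_; _,_; proj₁; proj₂)
open import Data.Sum using (_⊎_; inj₁; inj₂; [_,_]; swap) renaming (map to ⊎-map)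
open import Data.Nat using (ℕ; zero; suc; _≤_; _<_; z≤n; s<s⁻¹)
open import Data.Nat.Induction using (<-wellFounded)
open import Data.Nat.Properties using (≤-totalOrder; <-cmp; <-irrefl; <-trans; <⇒≱; m≤n⇒m<n∨m≡n; ≤-total; n≮0; 0≢1+n; suc-injective)
open import Data.Fin using (Fin; zero; suc; _≟_)
open import Data.Fin.Properties using (any?)
open import Data.Fin.Subset using (Subset; _∈_; _∉_; _⊆_; _─_; _-_; ∣_∣; ⁅_⁆; ⊤; inside; outside)
open import Data.Fin.Subset.Properties using (_∈?_; p⊂q⇒∣p∣<∣q∣; p─q⊆p; x∈p∧x≢y⇒x∈p-y; x∈⁅x⁆; x∈p⇒∣p-x∣<∣p∣; ∈⊤; x∈p∪q⁻; x∈p∪q⁺; x∈p∩q⁺)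
open import Data.Vec using (_∷_; there)
open import Data.List using (List; allFin; cartesianProduct; filter)
open import Data.List.Extrema ≤-totalOrder using (argmax; argmin; argmax-all; argmin-all; f[xs]≤f[argmax]; f[argmin]≤f[xs])
open import Data.List.Relation.Unary.All using (lookup)
open import Data.List.Relation.Unary.All.Properties using (all-filter)
import Data.List.Membership.Propositional as List
open import Data.List.Membership.Propositional.Properties using (∈-filter⁺; ∈-allFin; ∈-cartesianProduct⁺)
open import Relation.Nullary using (yes; no; ¬?; _×-dec_)
open import Relation.Unary using (Pred; Decidable)
open import Relation.Binary.Definitions using (Trichotomous; tri<; tri≈; tri>)
open import Relation.Binary.PropositionalEquality using (_≡_; _≢_; refl; sym; trans; cong; subst; subst₂; isEquivalence)
open import Induction.WellFounded using (module All)
import Relation.Binary.Construct.On as On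
open import Relation.Binary.Structures using (IsStrictTotalOrder)

module _ {A : Set} (xs : List A) (enumerates : ∀ x → x List.∈ xs)
         {P : Pred A 0ℓ} (P? : Decidable P) (f : A → ℕ) where

  maximiser : ∀ {x₀} → P x₀ → Σ A λ m → P m × (∀ {x} → P x → f x ≤ f m)
  maximiser {x₀} px₀ =
    argmax f x₀ (filter P? xs) ,
    argmax-all f px₀ (all-filter P? xs) ,
    λ px → lookup (f[xs]≤f[argmax] x₀ (filter P? xs)) (∈-filter⁺ P? (enumerates _) px)

  minimiser : ∀ {x₀} → P x₀ → Σ A λ m → P m × (∀ {x} → P x → f m ≤ f x)
  minimiser {x₀} px₀ =
    argmin f x₀ (filter P? xs) ,
    argmin-all f px₀ (all-filter P? xs) ,
    λ px → lookup (f[argmin]≤f[xs] x₀ (filter P? xs)) (∈-filter⁺ P? (enumerates _) px)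

allPairs : ∀ n → List (Fin n × Fin n)
allPairs n = cartesianProduct (allFin n) (allFin n)

∈-allPairs : ∀ {n} (st : Fin n × Fin n) → st List.∈ allPairs n
∈-allPairs (s , t) = ∈-cartesianProduct⁺ (∈-allFin s) (∈-allFin t)

injective⇒isStrictTotalOrder : ∀ {n} {f : Fin n → ℕ} → Injective _≡_ _≡_ f →
                               IsStrictTotalOrder _≡_ (_<_ on f)
injective⇒isStrictTotalOrder {f = f} f-inj = record
  { isStrictPartialOrder = record
    { isEquivalence = isEquivalence
    ; irrefl        = λ x≡y → <-irrefl (cong f x≡y)
    ; trans         = <-trans
    ; <-resp-≈      = (λ { refl lt → lt }) , (λ { refl lt → lt })
    }
  ; compare = compare
  }
  where
  compare : Trichotomous _≡_ (_<_ on f)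
  compare x y with <-cmp (f x) (f y)
  ... | tri< lt ≢ ≯ = tri< lt (λ x≡y → ≢ (cong f x≡y)) ≯
  ... | tri≈ ≮ eq ≯ = tri≈ ≮ (f-inj eq) ≯
  ... | tri> ≮ ≢ gt = tri> ≮ (λ x≡y → ≢ (cong f x≡y)) gt

x∈p─q⇒x∉q : ∀ {n} {x : Fin n} (p q : Subset n) → x ∈ p ─ q → x ∉ q
x∈p─q⇒x∉q {x = zero}  (_ ∷ _) (inside ∷ _)  ()        _
x∈p─q⇒x∉q {x = zero}  (_ ∷ _) (outside ∷ _) _         ()
x∈p─q⇒x∉q {x = suc x} (_ ∷ p) (_ ∷ q)       (there h) (there k) = x∈p─q⇒x∉q p q h k

module _ {n : ℕ} where

  ∈-⁺ : ∀ {x y : Fin n} {p} → x ∈ p → x ≢ y → x ∈ p - y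
  ∈-⁺ = x∈p∧x≢y⇒x∈p-y

  ∈-⁻ : ∀ {x y : Fin n} {p} → x ∈ p - y → x ∈ p
  ∈-⁻ {p = p} = p─q⊆p p _

  ∈-≢ : ∀ {x y : Fin n} {p} → x ∈ p - y → x ≢ y
  ∈-≢ {y = y} {p} x∈ refl = x∈p─q⇒x∉q p ⁅ y ⁆ x∈ (x∈⁅x⁆ y)

  ⊆∧∉⇒∣p∣<∣q∣ : ∀ {p q : Subset n} {x} → p ⊆ q → x ∈ q → x ∉ p → ∣ p ∣ < ∣ q ∣
  ⊆∧∉⇒∣p∣<∣q∣ p⊆q x∈q x∉p = p⊂q⇒∣p∣<∣q∣ (p⊆q , _ , x∈q , x∉p)

  Transit : Set
  Transit = Fin n → Fin n → Subset n

  _∖_ : Transit → Fin n → Transit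
  (R ∖ e) x y = R x y - e

  private
    variable
      Y Z S : Subset n
      R : Transit
      a a′ b c e f f′ m p q s t u v w x y z : Fin n

  TransitUnion : Subset n → Transit → Subset n → Subset n → Set
  TransitUnion Y R A B = Σ (Fin n) λ p → Σ (Fin n) λ q → p ∈ Y × q ∈ Y ×
    (∀ {z} → z ∈ R p q → z ∈ A ⊎ z ∈ B) × (∀ {z} → z ∈ A ⊎ z ∈ B → z ∈ R p q)

  record IsMonotoneUCTransitOn (Y : Subset n) (R : Transit) : Set where
    field
      closed   : x ∈ Y → y ∈ Y → R x y ⊆ Y
      t1       : x ∈ Y → y ∈ Y → x ∈ R x y
      t2       : x ∈ Y → y ∈ Y → z ∈ R x y → z ∈ R y x
      monotone : u ∈ Y → v ∈ Y → p ∈ R u v → q ∈ R u v → R p q ⊆ R u v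
      uc       : x ∈ Y → y ∈ Y → u ∈ Y → v ∈ Y → w ∈ R x y → w ∈ R u v →
                 TransitUnion Y R (R x y) (R u v)

  -- By monotonicity, b ∈ R e c means R e b ⊆ R e c.
  IsEnd : Subset n → Transit → Fin n → Set
  IsEnd Y R e = e ∈ Y × (∀ {b c} → b ∈ Y → c ∈ Y → b ∈ R e c ⊎ c ∈ R e b)

  record Ranking (Y : Subset n) (R : Transit) (e : Fin n) : Set where
    field
      rank      : Fin n → ℕ
      injective : x ∈ Y → y ∈ Y → rank x ≡ rank y → x ≡ y
      convex    : x ∈ Y → y ∈ Y → c ∈ Y → a ∈ R x y → b ∈ R x y →
                  rank a < rank c → rank c < rank b → c ∈ R x y
      first     : x ∈ Y → rank e ≤ rank x

  record Ends (Y : Subset n) (R : Transit) : Set where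
    field
      left right : Fin n
      left-end   : IsEnd Y R left
      right-end  : IsEnd Y R right
      spanning   : Y ⊆ R left right

  module Properties (T : IsMonotoneUCTransitOn Y R) where
    open IsMonotoneUCTransitOn T

    ∈-right : x ∈ Y → y ∈ Y → y ∈ R x y
    ∈-right xY yY = t2 yY xY (t1 yY xY)

    triangle : x ∈ Y → y ∈ Y → z ∈ Y → w ∈ R x z → w ∈ R x y ⊎ w ∈ R y z
    triangle xY yY zY w∈xz with uc xY yY yY zY (∈-right xY yY) (t1 yY zY)
    ... | p , q , pY , qY , ⊆∪ , ∪⊆ =
      ⊆∪ (monotone pY qY (∪⊆ (inj₁ (t1 xY yY))) (∪⊆ (inj₂ (∈-right yY zY))) w∈xz)

    -- With R x z ∪ R y z = R p q, the triangle puts every point of it outside R x y into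
    -- R x z ∩ R y z; so p ∉ R x y would put p and q together into R x z or into R y z,
    -- making y ∈ R x z or x ∈ R y z. Hence p, q ∈ R x y and z ∈ R p q ⊆ R x y.
    betweenness : x ∈ Y → y ∈ Y → z ∈ Y → y ∈ R x z ⊎ x ∈ R y z ⊎ z ∈ R x y
    betweenness {x} {y} {z} xY yY zY with y ∈? R x z | x ∈? R y z
    ... | yes y∈xz | _        = inj₁ y∈xz
    ... | no _     | yes x∈yz = inj₂ (inj₁ x∈yz)
    ... | no y∉xz  | no x∉yz  with uc xY zY yY zY (∈-right xY zY) (∈-right yY zY)
    ...   | p , q , pY , qY , ⊆∪ , ∪⊆ =
      inj₂ (inj₂ (monotone xY yY p∈xy q∈xy (∪⊆ (inj₁ (∈-right xY zY)))))
      where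
      in-both : w ∈ R x z ⊎ w ∈ R y z → w ∉ R x y → w ∈ R x z × w ∈ R y z
      in-both (inj₁ w∈xz) w∉xy with triangle xY yY zY w∈xz
      ... | inj₁ w∈xy = ⊥-elim (w∉xy w∈xy)
      ... | inj₂ w∈yz = w∈xz , w∈yz
      in-both (inj₂ w∈yz) w∉xy with triangle yY xY zY w∈yz
      ... | inj₁ w∈yx = ⊥-elim (w∉xy (t2 yY xY w∈yx))
      ... | inj₂ w∈xz = w∈xz , w∈yz

      ∈xy : (∀ {w} → w ∈ R x z ⊎ w ∈ R y z → w ∈ R s t) →
            s ∈ R x z ⊎ s ∈ R y z → t ∈ R x z ⊎ t ∈ R y z → s ∈ R x y
      ∈xy {s} ∪⊆st s∈∪ t∈∪ with s ∈? R x y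
      ... | yes s∈xy = s∈xy
      ... | no s∉xy with in-both s∈∪ s∉xy | t∈∪
      ...   | s∈xz , _ | inj₁ t∈xz = ⊥-elim (y∉xz (monotone xY zY s∈xz t∈xz (∪⊆st (inj₂ (t1 yY zY)))))
      ...   | _ , s∈yz | inj₂ t∈yz = ⊥-elim (x∉yz (monotone yY zY s∈yz t∈yz (∪⊆st (inj₁ (t1 xY zY)))))

      p∈xy : p ∈ R x y
      p∈xy = ∈xy ∪⊆ (⊆∪ (t1 pY qY)) (⊆∪ (∈-right pY qY))

      q∈xy : q ∈ R x y
      q∈xy = ∈xy (λ h → t2 pY qY (∪⊆ h)) (⊆∪ (∈-right pY qY)) (⊆∪ (t1 pY qY))

    spanning-pair : S ⊆ Y → s ∈ S → Σ (Fin n) λ p → Σ (Fin n) λ q → p ∈ S × q ∈ S × S ⊆ R p q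
    spanning-pair {S} S⊆Y s∈S with maximiser (allPairs n) ∈-allPairs
                                     (λ (p , q) → p ∈? S ×-dec q ∈? S) (λ (p , q) → ∣ R p q ∣) (s∈S , s∈S)
    ... | (p , q) , (p∈S , q∈S) , largest = p , q , p∈S , q∈S , covers
      where
      pY : p ∈ Y
      pY = S⊆Y p∈S
      qY : q ∈ Y
      qY = S⊆Y q∈S

      no-larger : t ∈ S → z ∈ S → R p q ⊆ R t z → z ∈ R p q
      no-larger {t} {z} t∈S z∈S pq⊆tz with z ∈? R p q
      ... | yes z∈pq = z∈pq
      ... | no z∉pq  = ⊥-elim (<⇒≱ (⊆∧∉⇒∣p∣<∣q∣ pq⊆tz (∈-right (S⊆Y t∈S) (S⊆Y z∈S)) z∉pq)
                                   (largest {t , z} (t∈S , z∈S)))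

      covers : S ⊆ R p q
      covers z∈S with betweenness pY qY (S⊆Y z∈S)
      ... | inj₁ q∈pz        = no-larger p∈S z∈S (monotone pY (S⊆Y z∈S) (t1 pY (S⊆Y z∈S)) q∈pz)
      ... | inj₂ (inj₁ p∈qz) = no-larger q∈S z∈S (monotone qY (S⊆Y z∈S) p∈qz (t1 qY (S⊆Y z∈S)))
      ... | inj₂ (inj₂ z∈pq) = z∈pq

    nearest : IsEnd Y R e → {P : Pred (Fin n) 0ℓ} → Decidable P → (∀ {x} → P x → x ∈ Y) → P y →
              Σ (Fin n) λ m → P m × (∀ {x} → P x → R e m ⊆ R e x)
    nearest {e = e} (eY , chain) {P} P? P⊆Y py with minimiser (allFin n) ∈-allFin P? (λ x → ∣ R e x ∣) py
    ... | m , pm , smallest = m , pm , em⊆ex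
      where
      em⊆ex : P x → R e m ⊆ R e x
      em⊆ex {x} px {w} w∈em with chain (P⊆Y px) (P⊆Y pm)
      ... | inj₂ m∈ex = monotone eY (P⊆Y px) (t1 eY (P⊆Y px)) m∈ex w∈em
      ... | inj₁ x∈em with w ∈? R e x
      ...   | yes w∈ex = w∈ex
      ...   | no w∉ex  = ⊥-elim (<⇒≱ (⊆∧∉⇒∣p∣<∣q∣ ex⊆em w∈em w∉ex) (smallest px))
        where
        ex⊆em : R e x ⊆ R e m
        ex⊆em = monotone eY (P⊆Y pm) (t1 eY (P⊆Y pm)) x∈em

  restrict : IsMonotoneUCTransitOn Y R → Z ⊆ Y → (∀ {x y} → x ∈ Z → y ∈ Z → R x y ⊆ Z) →
             IsMonotoneUCTransitOn Z R
  restrict {Y} {R} {Z} T Z⊆Y Z-closed = record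
    { closed   = Z-closed
    ; t1       = λ xZ yZ → t1 (Z⊆Y xZ) (Z⊆Y yZ)
    ; t2       = λ xZ yZ → t2 (Z⊆Y xZ) (Z⊆Y yZ)
    ; monotone = λ uZ vZ → monotone (Z⊆Y uZ) (Z⊆Y vZ)
    ; uc       = ucZ
    }
    where
    open IsMonotoneUCTransitOn T
    open Properties T using (∈-right)

    ucZ : x ∈ Z → y ∈ Z → u ∈ Z → v ∈ Z → w ∈ R x y → w ∈ R u v → TransitUnion Z R (R x y) (R u v)
    ucZ {x} {y} {u} {v} xZ yZ uZ vZ w∈xy w∈uv with uc (Z⊆Y xZ) (Z⊆Y yZ) (Z⊆Y uZ) (Z⊆Y vZ) w∈xy w∈uv
    ... | p , q , pY , qY , ⊆∪ , ∪⊆ =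
      p , q , ∪⊆Z (⊆∪ (t1 pY qY)) , ∪⊆Z (⊆∪ (∈-right pY qY)) , ⊆∪ , ∪⊆
      where
      ∪⊆Z : z ∈ R x y ⊎ z ∈ R u v → z ∈ Z
      ∪⊆Z = [ Z-closed xZ yZ , Z-closed uZ vZ ]

  remove : IsMonotoneUCTransitOn Y R → Z ⊆ Y → e ∉ Z → (∀ {x y} → x ∈ Z → y ∈ Z → R x y - e ⊆ Z) →
           IsMonotoneUCTransitOn Z (R ∖ e)
  remove {Y} {R} {Z} {e} T Z⊆Y e∉Z Z-closed = record
    { closed   = Z-closed
    ; t1       = λ xZ yZ → ∈-⁺ (t1 (Z⊆Y xZ) (Z⊆Y yZ)) (≢e xZ)
    ; t2       = λ xZ yZ z∈ → ∈-⁺ (t2 (Z⊆Y xZ) (Z⊆Y yZ) (∈-⁻ z∈)) (∈-≢ z∈)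
    ; monotone = λ uZ vZ p∈ q∈ z∈ → ∈-⁺ (monotone (Z⊆Y uZ) (Z⊆Y vZ) (∈-⁻ p∈) (∈-⁻ q∈) (∈-⁻ z∈)) (∈-≢ z∈)
    ; uc       = ucZ
    }
    where
    open IsMonotoneUCTransitOn T
    open Properties T using (spanning-pair)

    ≢e : x ∈ Z → x ≢ e
    ≢e xZ refl = e∉Z xZ

    -- R p q - e need not be a transit set, but it is R p′ q′ - e for a spanning pair p′, q′.
    ucZ : x ∈ Z → y ∈ Z → u ∈ Z → v ∈ Z → w ∈ R x y - e → w ∈ R u v - e →
          TransitUnion Z (R ∖ e) (R x y - e) (R u v - e)
    ucZ {x} {y} {u} {v} xZ yZ uZ vZ w∈xy w∈uv
      with uc (Z⊆Y xZ) (Z⊆Y yZ) (Z⊆Y uZ) (Z⊆Y vZ) (∈-⁻ w∈xy) (∈-⁻ w∈uv)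
    ... | p , q , pY , qY , ⊆∪ , ∪⊆
      with spanning-pair (λ z∈ → closed pY qY (∈-⁻ z∈)) (∈-⁺ (∪⊆ (inj₁ (∈-⁻ w∈xy))) (∈-≢ w∈xy))
    ...   | p′ , q′ , p′∈ , q′∈ , spans = p′ , q′ , ∪⊆Z p′∈ , ∪⊆Z q′∈ , ⊆∪′ , ∪⊆′
      where
      ∪⊆Z : z ∈ R p q - e → z ∈ Z
      ∪⊆Z z∈ = [ (λ h → Z-closed xZ yZ (∈-⁺ h (∈-≢ z∈))) , (λ h → Z-closed uZ vZ (∈-⁺ h (∈-≢ z∈))) ]
                 (⊆∪ (∈-⁻ z∈))
      ⊆∪′ : z ∈ R p′ q′ - e → z ∈ R x y - e ⊎ z ∈ R u v - e
      ⊆∪′ z∈ = ⊎-map (λ h → ∈-⁺ h (∈-≢ z∈)) (λ h → ∈-⁺ h (∈-≢ z∈))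
                     (⊆∪ (monotone pY qY (∈-⁻ p′∈) (∈-⁻ q′∈) (∈-⁻ z∈)))
      ∪⊆′ : z ∈ R x y - e ⊎ z ∈ R u v - e → z ∈ R p′ q′ - e
      ∪⊆′ {z} z∈ = ∈-⁺ (spans (∈-⁺ (∪⊆ (⊎-map ∈-⁻ ∈-⁻ z∈)) z≢e)) z≢e
        where
        z≢e : z ≢ e
        z≢e = [ ∈-≢ , ∈-≢ ] z∈

  prepend : IsMonotoneUCTransitOn Y R → e ∈ Y → f ∈ Y - e → (∀ {b} → b ∈ Y - e → f ∈ R e b) →
            Ranking (Y - e) (R ∖ e) f → Ranking Y R e
  prepend {Y} {R} {e} {f} T eY f∈ f∈eb ranking = record
    { rank      = rank
    ; injective = injective
    ; convex    = convex
    ; first     = λ _ → subst (_≤ rank _) (sym rank-e) z≤n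
    }
    where
    open IsMonotoneUCTransitOn T
    open Properties T using (∈-right; spanning-pair)
    module R₁ = Ranking ranking

    rank : Fin n → ℕ
    rank x with x ≟ e
    ... | yes _ = 0
    ... | no _  = suc (R₁.rank x)

    rank-e : rank e ≡ 0
    rank-e with e ≟ e
    ... | yes _   = refl
    ... | no e≢e = ⊥-elim (e≢e refl)

    rank-≢ : x ≢ e → rank x ≡ suc (R₁.rank x)
    rank-≢ {x} x≢e with x ≟ e
    ... | yes x≡e = ⊥-elim (x≢e x≡e)
    ... | no _    = refl

    above-e : rank a < rank c → c ≢ e
    above-e {a} a<c refl = n≮0 (subst (rank a <_) rank-e a<c)

    rank₁-< : a ≢ e → c ≢ e → rank a < rank c → R₁.rank a < R₁.rank c
    rank₁-< a≢e c≢e a<c = s<s⁻¹ (subst₂ _<_ (rank-≢ a≢e) (rank-≢ c≢e) a<c)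

    injective : x ∈ Y → y ∈ Y → rank x ≡ rank y → x ≡ y
    injective {x} {y} xY yY eq with x ≟ e | y ≟ e
    ... | yes x≡e | yes y≡e = trans x≡e (sym y≡e)
    ... | yes _   | no _    = ⊥-elim (0≢1+n eq)
    ... | no _    | yes _   = ⊥-elim (0≢1+n (sym eq))
    ... | no x≢e  | no y≢e  = R₁.injective (∈-⁺ xY x≢e) (∈-⁺ yY y≢e) (suc-injective eq)

    f∈xy : x ∈ Y → y ∈ Y → e ∈ R x y → b ∈ R x y - e → f ∈ R x y
    f∈xy xY yY e∈xy b∈ = monotone xY yY e∈xy (∈-⁻ b∈) (f∈eb (∈-⁺ (closed xY yY (∈-⁻ b∈)) (∈-≢ b∈)))

    -- f is the R₁-least point of R x y - e, which R₁ sees as an interval once it is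
    -- written as R p q - e with p, q ∈ R x y.
    convex-∋e : x ∈ Y → y ∈ Y → e ∈ R x y → c ∈ Y - e → b ∈ R x y - e →
                R₁.rank c < R₁.rank b → c ∈ R x y
    convex-∋e {x} {y} {c} xY yY e∈xy c∈ b∈ c<b
      with spanning-pair (λ z∈ → closed xY yY (∈-⁻ z∈)) b∈ | m≤n⇒m<n∨m≡n (R₁.first c∈)
    ... | _ | inj₂ f≡c = subst (_∈ R x y) (R₁.injective f∈ c∈ f≡c) (f∈xy xY yY e∈xy b∈)
    ... | p , q , p∈ , q∈ , spans | inj₁ f<c = monotone xY yY (∈-⁻ p∈) (∈-⁻ q∈) (∈-⁻ c∈pq)
      where
      ∈Y-e : z ∈ R x y - e → z ∈ Y - e
      ∈Y-e z∈ = ∈-⁺ (closed xY yY (∈-⁻ z∈)) (∈-≢ z∈)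
      ∈pq-e : z ∈ R x y - e → z ∈ R p q - e
      ∈pq-e z∈ = ∈-⁺ (spans z∈) (∈-≢ z∈)
      c∈pq : c ∈ R p q - e
      c∈pq = R₁.convex (∈Y-e p∈) (∈Y-e q∈) c∈ (∈pq-e (∈-⁺ (f∈xy xY yY e∈xy b∈) (∈-≢ f∈))) (∈pq-e b∈)
                       f<c c<b

    convex-∌e : x ∈ Y → y ∈ Y → e ∉ R x y → c ∈ Y - e → a ∈ R x y → b ∈ R x y - e →
                R₁.rank a < R₁.rank c → R₁.rank c < R₁.rank b → c ∈ R x y
    convex-∌e {x} {y} xY yY e∉xy c∈ a∈ b∈ a<c c<b =
      ∈-⁻ (R₁.convex (∈-⁺ xY (≢e (t1 xY yY))) (∈-⁺ yY (≢e (∈-right xY yY))) c∈ (∈-⁺ a∈ (≢e a∈)) b∈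
                     a<c c<b)
      where
      ≢e : z ∈ R x y → z ≢ e
      ≢e z∈ refl = e∉xy z∈

    convex : x ∈ Y → y ∈ Y → c ∈ Y → a ∈ R x y → b ∈ R x y →
             rank a < rank c → rank c < rank b → c ∈ R x y
    convex {x} {y} {c} {a} {b} xY yY cY a∈ b∈ a<c c<b with e ∈? R x y | above-e a<c | above-e c<b
    ... | yes e∈xy | c≢e | b≢e = convex-∋e xY yY e∈xy (∈-⁺ cY c≢e) (∈-⁺ b∈ b≢e)
                                            (rank₁-< c≢e b≢e c<b)
    ... | no e∉xy  | c≢e | b≢e = convex-∌e xY yY e∉xy (∈-⁺ cY c≢e) a∈ (∈-⁺ b∈ b≢e)
                                            (rank₁-< a≢e c≢e a<c) (rank₁-< c≢e b≢e c<b)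
      where
      a≢e : a ≢ e
      a≢e refl = e∉xy a∈

  remove-point : IsMonotoneUCTransitOn Y R → IsMonotoneUCTransitOn (Y - e) (R ∖ e)
  remove-point T = remove T ∈-⁻ (λ e∈ → ∈-≢ e∈ refl)
                          (λ x∈ y∈ z∈ → ∈-⁺ (closed (∈-⁻ x∈) (∈-⁻ y∈) (∈-⁻ z∈)) (∈-≢ z∈))
    where open IsMonotoneUCTransitOn T

  trivial-ranking : (∀ {x} → x ∈ Y → x ≡ e) → Ranking Y R e
  trivial-ranking Y≡e = record
    { rank      = λ _ → 0
    ; injective = λ xY yY _ → trans (Y≡e xY) (sym (Y≡e yY))
    ; convex    = λ _ _ _ _ _ 0<0 _ → ⊥-elim (n≮0 0<0)
    ; first     = λ _ → z≤n
    }

  Linearisable : Subset n → Set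
  Linearisable Y = ∀ {R} → IsMonotoneUCTransitOn Y R →
                   (∀ {e} → IsEnd Y R e → Ranking Y R e) × (∀ {y} → y ∈ Y → Ends Y R)

  module SuccessorEnd {Y : Subset n} {R : Transit} {e m : Fin n}
                      (T : IsMonotoneUCTransitOn Y R) (IH : ∀ {Z} → ∣ Z ∣ < ∣ Y ∣ → Linearisable Z)
                      (e-end : IsEnd Y R e) (m∈ : m ∈ Y - e)
                      (m-nearest : ∀ {x} → x ∈ Y - e → R e m ⊆ R e x)
                      where
    open IsMonotoneUCTransitOn T
    open Properties T

    eY : e ∈ Y
    eY = proj₁ e-end

    mY : m ∈ Y
    mY = ∈-⁻ m∈

    A : Subset n
    A = R e m

    K : Subset n
    K = A - e

    K⊆Y : K ⊆ Y
    K⊆Y z∈ = closed eY mY (∈-⁻ z∈)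

    ef⊆A : f ∈ K → R e f ⊆ A
    ef⊆A f∈ = monotone eY mY (t1 eY mY) (∈-⁻ f∈)

    e∉K : e ∉ K
    e∉K e∈ = ∈-≢ e∈ refl

    TK : IsMonotoneUCTransitOn K (R ∖ e)
    TK = remove T K⊆Y e∉K (λ x∈ y∈ z∈ → ∈-⁺ (monotone eY mY (∈-⁻ x∈) (∈-⁻ y∈) (∈-⁻ z∈)) (∈-≢ z∈))

    open Ends (proj₂ (IH (⊆∧∉⇒∣p∣<∣q∣ K⊆Y eY e∉K) TK) (∈-⁺ (∈-right eY mY) (∈-≢ m∈)))

    lK : left ∈ K
    lK = proj₁ left-end

    rK : right ∈ K
    rK = proj₁ right-end

    Escapes : Fin n → Set
    Escapes f = ∀ {c} → c ∈ Y → c ∉ A → K ⊆ R f c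

    -- z is the point outside A nearest to e; it lies in every R f c with c ∉ A.
    escapes : z ∈ Y → z ∉ A → (∀ {c} → c ∈ Y × c ∉ A → R e z ⊆ R e c) →
              f ∈ K → K ⊆ R f f′ → f′ ∈ R f z → Escapes f
    escapes {z} {f} {f′} zY z∉A z-nearest f∈ K⊆ff′ f′∈fz {c} cY c∉A k∈ =
      monotone fY cY (t1 fY cY) f′∈fc (K⊆ff′ k∈)
      where
      fY : f ∈ Y
      fY = K⊆Y f∈
      z∈fc : z ∈ R f c
      z∈fc with triangle eY fY cY (z-nearest (cY , c∉A) (∈-right eY zY))
      ... | inj₁ z∈ef = ⊥-elim (z∉A (ef⊆A f∈ z∈ef))
      ... | inj₂ z∈fc = z∈fc
      f′∈fc : f′ ∈ R f c
      f′∈fc = monotone fY cY (t1 fY cY) z∈fc f′∈fz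

    escaping-end : Σ (Fin n) λ f → IsEnd K (R ∖ e) f × Escapes f
    escaping-end with any? (λ c → c ∈? Y ×-dec ¬? (c ∈? A))
    ... | no all-in-A = left , left-end , λ cY c∉A → ⊥-elim (all-in-A (_ , cY , c∉A))
    ... | yes (_ , c₀∈) with nearest e-end (λ c → c ∈? Y ×-dec ¬? (c ∈? A)) proj₁ c₀∈
    ...   | z , (zY , z∉A) , z-nearest with betweenness (K⊆Y lK) (K⊆Y rK) zY
    ...     | inj₁ r∈lz        =
      left , left-end , escapes zY z∉A z-nearest lK (λ k∈ → ∈-⁻ (spanning k∈)) r∈lz
    ...     | inj₂ (inj₁ l∈rz) =
      right , right-end , escapes zY z∉A z-nearest rK (λ k∈ → t2 (K⊆Y lK) (K⊆Y rK) (∈-⁻ (spanning k∈))) l∈rz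
    ...     | inj₂ (inj₂ z∈lr) = ⊥-elim (z∉A (monotone eY mY (∈-⁻ lK) (∈-⁻ rK) z∈lr))

    successor : Σ (Fin n) λ f → f ∈ K × IsEnd (Y - e) (R ∖ e) f
    successor with escaping-end
    ... | f , (f∈K , K-chain) , f-escapes = f , f∈K , ∈-⁺ fY (∈-≢ f∈K) , chain
      where
      fY : f ∈ Y
      fY = K⊆Y f∈K

      ordered : b ∈ Y - e → c ∈ Y - e → b ∈ R e c → b ∈ R f c ⊎ c ∈ R f b
      ordered {b} {c} b∈ c∈ b∈ec with b ∈? A | c ∈? A
      ... | no b∉A  | _       = inj₁ ([ (λ b∈ef → ⊥-elim (b∉A (ef⊆A f∈K b∈ef))) , id ]
                                        (triangle eY fY (∈-⁻ c∈) b∈ec))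
      ... | yes b∈A | no c∉A  = inj₁ (f-escapes (∈-⁻ c∈) c∉A (∈-⁺ b∈A (∈-≢ b∈)))
      ... | yes b∈A | yes c∈A = ⊎-map ∈-⁻ ∈-⁻ (K-chain (∈-⁺ b∈A (∈-≢ b∈)) (∈-⁺ c∈A (∈-≢ c∈)))

      chain : b ∈ Y - e → c ∈ Y - e → b ∈ R f c - e ⊎ c ∈ R f b - e
      chain b∈ c∈ with proj₂ e-end (∈-⁻ b∈) (∈-⁻ c∈)
      ... | inj₁ b∈ec = ⊎-map (λ h → ∈-⁺ h (∈-≢ b∈)) (λ h → ∈-⁺ h (∈-≢ c∈))
                              (ordered b∈ c∈ b∈ec)
      ... | inj₂ c∈eb = ⊎-map (λ h → ∈-⁺ h (∈-≢ b∈)) (λ h → ∈-⁺ h (∈-≢ c∈))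
                              (swap (ordered c∈ b∈ c∈eb))

  ranking-from-end : (∀ {Z} → ∣ Z ∣ < ∣ Y ∣ → Linearisable Z) → IsMonotoneUCTransitOn Y R →
                     IsEnd Y R e → Ranking Y R e
  ranking-from-end {Y} {e = e} IH T e-end with any? (_∈? Y - e)
  ... | no only-e = trivial-ranking Y≡e
    where
    Y≡e : x ∈ Y → x ≡ e
    Y≡e {x} xY with x ≟ e
    ... | yes x≡e = x≡e
    ... | no x≢e  = ⊥-elim (only-e (x , ∈-⁺ xY x≢e))
  ... | yes (_ , x₀∈) with Properties.nearest T e-end (_∈? Y - e) ∈-⁻ x₀∈
  ...   | m , m∈ , m-nearest with SuccessorEnd.successor T IH e-end m∈ m-nearest
  ...     | f , f∈K , f-end =
    prepend T (proj₁ e-end) (proj₁ f-end) (λ b∈ → m-nearest b∈ (∈-⁻ f∈K))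
            (proj₁ (IH (x∈p⇒∣p-x∣<∣p∣ (proj₁ e-end)) (remove-point T)) f-end)

  Proper : Subset n → Transit → Fin n × Fin n → Set
  Proper Y R (s , t) = s ∈ Y × t ∈ Y × ∃ λ y → y ∈ Y × y ∉ R s t

  proper? : ∀ (Y : Subset n) R → Decidable (Proper Y R)
  proper? Y R (s , t) = s ∈? Y ×-dec t ∈? Y ×-dec any? (λ y → y ∈? Y ×-dec ¬? (y ∈? R s t))

  module LargestProper {Y : Subset n} {R : Transit} {u v z : Fin n}
                       (T : IsMonotoneUCTransitOn Y R) (IH : ∀ {Z} → ∣ Z ∣ < ∣ Y ∣ → Linearisable Z)
                       (uY : u ∈ Y) (vY : v ∈ Y) (zY : z ∈ Y) (z∉A : z ∉ R u v)
                       (largest : ∀ {st} → Proper Y R st → ∣ R (proj₁ st) (proj₂ st) ∣ ≤ ∣ R u v ∣)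
                       where
    open IsMonotoneUCTransitOn T
    open Properties T

    A : Subset n
    A = R u v

    A⊆Y : A ⊆ Y
    A⊆Y = closed uY vY

    open Ends (proj₂ (IH (⊆∧∉⇒∣p∣<∣q∣ A⊆Y zY z∉A) (restrict T A⊆Y (monotone uY vY))) (t1 uY vY))

    lA : left ∈ A
    lA = proj₁ left-end

    rA : right ∈ A
    rA = proj₁ right-end

    strictly-above-A : s ∈ Y → t ∈ Y → A ⊆ R s t → w ∈ R s t → w ∉ A → Y ⊆ R s t
    strictly-above-A {s} {t} sY tY A⊆st w∈st w∉A {y} yY with y ∈? R s t
    ... | yes y∈st = y∈st
    ... | no y∉st  =
      ⊥-elim (<⇒≱ (⊆∧∉⇒∣p∣<∣q∣ A⊆st w∈st w∉A) (largest {s , t} (sY , tY , y , yY , y∉st)))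

    -- For b ∉ A, R a b ∪ A is a transit set by (uc) and strictly contains A, so it is Y.
    end-of-Y : IsEnd A R a → a′ ∈ A → A ⊆ R a a′ → a′ ∈ R a z → IsEnd Y R a
    end-of-Y {a} {a′} (a∈A , A-chain) a′∈A A⊆aa′ a′∈az = aY , chain
      where
      aY : a ∈ Y
      aY = A⊆Y a∈A

      beyond : b ∈ Y → b ∉ A → Y ⊆ R a b
      beyond {b} bY b∉A with uc aY bY uY vY (t1 aY bY) a∈A
      ... | p , q , pY , qY , ⊆∪ , ∪⊆ = Y⊆ab
        where
        Y⊆ab∪A : y ∈ Y → y ∈ R a b ⊎ y ∈ A
        Y⊆ab∪A yY =
          ⊆∪ (strictly-above-A pY qY (λ y∈A → ∪⊆ (inj₂ y∈A)) (∪⊆ (inj₁ (∈-right aY bY))) b∉A yY)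
        z∈ab : z ∈ R a b
        z∈ab = [ id , (λ z∈A → ⊥-elim (z∉A z∈A)) ] (Y⊆ab∪A zY)
        A⊆ab : A ⊆ R a b
        A⊆ab y∈A = monotone aY bY (t1 aY bY) (monotone aY bY (t1 aY bY) z∈ab a′∈az) (A⊆aa′ y∈A)
        Y⊆ab : Y ⊆ R a b
        Y⊆ab yY = [ id , A⊆ab ] (Y⊆ab∪A yY)

      chain : b ∈ Y → c ∈ Y → b ∈ R a c ⊎ c ∈ R a b
      chain {b} {c} bY cY with b ∈? A | c ∈? A
      ... | no b∉A  | _       = inj₂ (beyond bY b∉A cY)
      ... | yes _   | no c∉A  = inj₁ (beyond cY c∉A bY)
      ... | yes b∈A | yes c∈A = A-chain b∈A c∈A

    end : Σ (Fin n) (IsEnd Y R)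
    end with betweenness (A⊆Y lA) (A⊆Y rA) zY
    ... | inj₁ r∈lz        = left , end-of-Y left-end rA spanning r∈lz
    ... | inj₂ (inj₁ l∈rz) =
      right , end-of-Y right-end lA (λ y∈ → t2 (A⊆Y lA) (A⊆Y rA) (spanning y∈)) l∈rz
    ... | inj₂ (inj₂ z∈lr) = ⊥-elim (z∉A (monotone uY vY lA rA z∈lr))

  end-exists : (∀ {Z} → ∣ Z ∣ < ∣ Y ∣ → Linearisable Z) → IsMonotoneUCTransitOn Y R →
               y ∈ Y → Σ (Fin n) (IsEnd Y R)
  end-exists {Y} {R} {y} IH T yY with any? (λ s → any? (λ t → proper? Y R (s , t)))
  ... | no none-proper = y , yY , λ bY cY → inj₁ (full yY cY bY)
    where
    full : s ∈ Y → t ∈ Y → Y ⊆ R s t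
    full {s} {t} sY tY {x} xY with x ∈? R s t
    ... | yes x∈st = x∈st
    ... | no x∉st  = ⊥-elim (none-proper (s , t , sY , tY , x , xY , x∉st))
  ... | yes (_ , _ , st-proper)
    with maximiser (allPairs n) ∈-allPairs (proper? Y R) (λ (s , t) → ∣ R s t ∣) st-proper
  ...   | (u , v) , (uY , vY , z , zY , z∉uv) , largest = LargestProper.end T IH uY vY zY z∉uv largest

  module _ {Y : Subset n} {R : Transit} {e : Fin n} (T : IsMonotoneUCTransitOn Y R) (ρ : Ranking Y R e) where
    open IsMonotoneUCTransitOn T
    open Properties T using (∈-right)
    open Ranking ρ

    ranked-between : s ∈ Y → t ∈ Y → w ∈ Y → rank s ≤ rank w → rank w ≤ rank t → w ∈ R s t
    ranked-between sY tY wY s≤w w≤t with m≤n⇒m<n∨m≡n s≤w | m≤n⇒m<n∨m≡n w≤t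
    ... | inj₂ s≡w | _        = subst (_∈ R _ _) (injective sY wY s≡w) (t1 sY tY)
    ... | inj₁ _   | inj₂ w≡t = subst (_∈ R _ _) (sym (injective wY tY w≡t)) (∈-right sY tY)
    ... | inj₁ s<w | inj₁ w<t = convex sY tY wY (t1 sY tY) (∈-right sY tY) s<w w<t

    ends-from-ranking : IsEnd Y R e → Ends Y R
    ends-from-ranking e-end with maximiser (allFin n) ∈-allFin (_∈? Y) rank (proj₁ e-end)
    ... | g , gY , g-last = record
      { left      = e
      ; right     = g
      ; left-end  = e-end
      ; right-end = gY , g-chain
      ; spanning  = λ yY → ranked-between (proj₁ e-end) gY yY (first yY) (g-last yY)
      }
      where
      g-chain : b ∈ Y → c ∈ Y → b ∈ R g c ⊎ c ∈ R g b
      g-chain {b} {c} bY cY with ≤-total (rank b) (rank c)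
      ... | inj₁ b≤c = inj₂ (t2 bY gY (ranked-between bY gY cY b≤c (g-last cY)))
      ... | inj₂ c≤b = inj₁ (t2 cY gY (ranked-between cY gY bY c≤b (g-last bY)))

  linearisable : ∀ Y → Linearisable Y
  linearisable = All.wfRec (On.wellFounded ∣_∣ <-wellFounded) 0ℓ Linearisable step
    where
    step : ∀ Y → (∀ {Z} → ∣ Z ∣ < ∣ Y ∣ → Linearisable Z) → Linearisable Y
    step Y IH {R} T = rankings , ends
      where
      rankings : IsEnd Y R e → Ranking Y R e
      rankings = ranking-from-end IH T
      ends : y ∈ Y → Ends Y R
      ends y∈ with end-exists IH T y∈
      ... | e , e-end = ends-from-ranking T (rankings e-end) e-end

full-system : ∀ {n} {R : Transit {n}} → IsTransit R → Monotone R → UC R → IsMonotoneUCTransitOn ⊤ R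
full-system {R = R} transit mono uc = record
  { closed   = λ _ _ _ → ∈⊤
  ; t1       = λ {x} {y} _ _ → IsTransit.t1 transit x y
  ; t2       = λ {x} {y} _ _ → subst (_ ∈_) (IsTransit.t2 transit x y)
  ; monotone = λ {u} {v} {p} {q} _ _ → mono u v p q
  ; uc       = uc⊤
  }
  where
  uc⊤ : ∀ {x y u v w} → x ∈ ⊤ → y ∈ ⊤ → u ∈ ⊤ → v ∈ ⊤ → w ∈ R x y → w ∈ R u v →
        TransitUnion ⊤ R (R x y) (R u v)
  uc⊤ {x} {y} {u} {v} {w} _ _ _ _ w∈xy w∈uv
    with uc x y u v (λ empty → empty (w , x∈p∩q⁺ (w∈xy , w∈uv)))
  ... | p , q , _ , _ , xy∪uv≡pq =
    p , q , ∈⊤ , ∈⊤ , (λ z∈ → x∈p∪q⁻ (R x y) (R u v) (subst (_ ∈_) (sym xy∪uv≡pq) z∈))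
                    , (λ z∈ → subst (_ ∈_) xy∪uv≡pq (x∈p∪q⁺ z∈))

corollary3 : (n : ℕ) (R : Fin (suc n) → Fin (suc n) → Subset (suc n)) →
    IsTransit R → Monotone R → UC R → PrePyramidal R
corollary3 n R transit mono uc =
  -- Without the explicit f, unification would unfold rank and so run the whole recursion.
  (_<_ on rank) , injective⇒isStrictTotalOrder {f = rank} rank-injective , intervals
  where
  T : IsMonotoneUCTransitOn ⊤ R
  T = full-system transit mono uc

  ends : Ends ⊤ R
  ends = proj₂ (linearisable ⊤ T) (∈⊤ {x = zero})

  ρ : Ranking ⊤ R (Ends.left ends)
  ρ = proj₁ (linearisable ⊤ T) (Ends.left-end ends)

  open Ranking ρ

  rank-injective : Injective _≡_ _≡_ rank
  rank-injective = injective ∈⊤ ∈⊤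

  intervals : ∀ x y → IsInterval (_<_ on rank) (R x y)
  intervals x y a b c = convex ∈⊤ ∈⊤ ∈⊤
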